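{- Let $G$ be a finite group and $H$ a non-trivial normal subgroup of $G$. Let $\tau$ be an integer with $1\leq\tau\leq|H|$. If $\tau$ is odd, then $H$ is a $(0,\tau)$-regular set of $G$ if and only if $H$ is a perfect code of $G$.
   Context: All graphs are finite, undirected and simple. For a finite group $G$ and an inverse-closed subset $X\subseteq G\setminus\{1\}$, the Cayley graph $\mathrm{Cay}(G,X)$ has vertex set $G$ and edge set $\{\{g,gx\}: g\in G, x\in X\}$. For nonnegative integers $\kappa,\tau$, a subset $R$ of the vertex set of a graph $\Gamma$ is a $(\kappa,\tau)$-regular set of $\Gamma$ if every vertex in $R$ is adjacent to exactly $\kappa$ vertices of $R$ and every vertex outside $R$ is adjacent to exactly $\tau$ vertices of $R$. A subset $R\subseteq G$ is a $(\kappa,\tau)$-regular set of $G$ if there is a Cayley graph $\Gamma$ on $G$ such that $R$ is a $(\kappa,\tau)$-regular set of $\Gamma$. A perfect code of $G$ here means a $(0,1)$-regular set of $G$ (equivalently, a subset $C$ of $G$ such that there is an inverse-closed subset $Y\ni 1$ of $G$ with every $g\in G$ expressible uniquely as $g=cy$ with $c\in C$, $y\in Y$). -}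

module Defs where

open import Data.Nat using (ℕ)
open import Data.Fin using (Fin)
open import Data.Fin.Subset using (Subset; _∈_; _∉_; _∩_; ∣_∣; inside; outside)
open import Data.Fin.Subset.Properties using (_∈?_)
open import Data.Vec using (tabulate)
open import Data.Product using (Σ; _×_; ∃)
open import Relation.Nullary using (¬_; does)
open import Relation.Binary.PropositionalEquality using (_≡_)
open import Data.Bool using (if_then_else_)

record FinGroup : Set where
  infixl 7 _·_
  field
    order : ℕ
    _·_   : Fin order → Fin order → Fin order
    e     : Fin order
    inv   : Fin order → Fin order
    assoc     : ∀ x y z → (x · y) · z ≡ x · (y · z)
    identityˡ : ∀ x → e · x ≡ x
    identityʳ : ∀ x → x · e ≡ x
    inverseˡ  : ∀ x → inv x · x ≡ e
    inverseʳ  : ∀ x → x · inv x ≡ e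

module _ (G : FinGroup) where
  open FinGroup G

  IsConnectionSet : Subset order → Set
  IsConnectionSet X = (e ∉ X) × (∀ x → x ∈ X → inv x ∈ X)

  -- Neighbourhood of g in Cay(G,X): { h | g⁻¹ h ∈ X } = { g x | x ∈ X }.
  nbhd : Subset order → Fin order → Subset order
  nbhd X g = tabulate (λ h → if does (inv g · h ∈? X) then inside else outside)

  IsRegularSetOfCay : Subset order → ℕ → ℕ → Subset order → Set
  IsRegularSetOfCay X κ τ R =
    (∀ g → g ∈ R → ∣ R ∩ nbhd X g ∣ ≡ κ) ×
    (∀ g → g ∉ R → ∣ R ∩ nbhd X g ∣ ≡ τ)

  IsRegularSet : ℕ → ℕ → Subset order → Set
  IsRegularSet κ τ R =
    Σ (Subset order) (λ X → IsConnectionSet X × IsRegularSetOfCay X κ τ R)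

  IsPerfectCode : Subset order → Set
  IsPerfectCode C = IsRegularSet 0 1 C

  IsNormalSubgroup : Subset order → Set
  IsNormalSubgroup H =
    (e ∈ H) ×
    (∀ x y → x ∈ H → y ∈ H → x · y ∈ H) ×
    (∀ x → x ∈ H → inv x ∈ H) ×
    (∀ g h → h ∈ H → (g · h) · inv g ∈ H)

  IsNontrivial : Subset order → Set
  IsNontrivial H = ∃ λ h → h ∈ H × ¬ (h ≡ e)

-- In Cay(G, X) a vertex g has |X ∩ g⁻¹H| neighbours in H. So H is a (0,τ)-regular set iff some
-- inverse-closed X ⊆ G ∖ H meets every coset aH ≠ H in exactly τ elements, and a perfect code is the
-- case τ = 1. As H is normal, inversion maps aH onto a⁻¹H.
--
-- (⇒) If aH = a⁻¹H, then X ∩ aH is closed under z ↦ z⁻¹; its size τ is odd, so it contains some z = z⁻¹.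
-- Taking such a z in every self-inverse coset, and y ∈ aH together with y⁻¹ ∈ a⁻¹H for every pair
-- aH ≠ a⁻¹H, gives an inverse-closed Y ⊆ G ∖ H meeting each coset aH ≠ H once.
--
-- (⇐) Given such a Y, put y·S_y into X for each y ∈ Y, with S_y ⊆ H of size τ. Since
-- (y k)⁻¹ = y⁻¹ (y k⁻¹ y⁻¹), inverse-closedness asks S_{y⁻¹} to be the image of S_y under
-- k ↦ y k⁻¹ y⁻¹. For y ≠ y⁻¹ choose S_y freely for one member of the pair; for y = y⁻¹ this map is an
-- involution of H fixing 1, and such an involution has invariant subsets of every odd size up to |H|.

module Submission where

open import Algebra.Bundles using (Group)
import Algebra.Properties.CommutativeMonoid.Sum as Sum
import Algebra.Properties.Group
open import Data.Bool using (Bool; true; false; _∧_; _∨_; not; if_then_else_)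
import Data.Bool.Properties as Bool
open import Data.Bool.Properties
  using (∧-comm; ∨-comm; ∧-zeroʳ; ∧-identityʳ; ∧-conicalˡ; ∧-conicalʳ; not-injective; ⇔→≡)
open import Data.Empty using (⊥-elim)
open import Data.Fin using (Fin; zero; suc; _<_)
open import Data.Fin.Permutation using (permutation)
open import Data.Fin.Properties using (_≟_; _<?_; <-cmp; any?)
open import Data.Fin.Subset using (Subset; _∈_; _∉_; _∩_; ∣_∣; inside; outside)
open import Data.Fin.Subset.Properties using (_∈?_)
open import Data.Maybe using (Maybe; just; nothing; fromMaybe)
import Data.Maybe as Maybe
open import Data.Nat using (ℕ; zero; suc; _+_; _*_; _%_; _≤_; z≤n; s≤s)
open import Data.Nat.DivMod using (_/_; m*n%n≡0; m≡m%n+[m/n]*n)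
open import Data.Nat.Properties
  using (+-0-commutativeMonoid; +-suc; +-comm; +-identityʳ; *-comm; ≤-refl; ≤-reflexive; ≤-trans;
         <-irrefl; m≤n+m; +-mono-≤; +-cancelˡ-≤)
open import Data.Product using (_×_; _,_; proj₁; proj₂; ∃)
open import Data.Vec using ([]; _∷_; lookup; tabulate)
open import Data.Vec.Properties using ([]=⇒lookup; lookup⇒[]=; lookup-zipWith; lookup∘tabulate)
open import Function using (_∘_)
open import Function.Bundles using (_⇔_; mk⇔)
open import Level using (0ℓ)
open import Relation.Binary using (Tri; tri<; tri≈; tri>)
open import Relation.Binary.PropositionalEquality
open import Relation.Nullary using (¬?; yes; no; does; _×-dec_)
open import Relation.Nullary.Decidable using (dec-true; dec-false)

open import Defs

open ≡-Reasoning

module ℕ-Sum = Sum +-0-commutativeMonoid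

_⊆_ : ∀ {n} → (Fin n → Bool) → (Fin n → Bool) → Set
p ⊆ q = ∀ i → p i ≡ true → q i ≡ true

count : ∀ {n} → (Fin n → Bool) → ℕ
count p = ℕ-Sum.sum (λ i → if p i then 1 else 0)

count-cong : ∀ {n} {p q : Fin n → Bool} → (∀ i → p i ≡ q i) → count p ≡ count q
count-cong p≗q = ℕ-Sum.sum-cong-≗ (λ i → cong (if_then 1 else 0) (p≗q i))

count-permute : ∀ {n} (p : Fin n → Bool) (f g : Fin n → Fin n) →
                (∀ i → f (g i) ≡ i) → (∀ i → g (f i) ≡ i) → count (p ∘ f) ≡ count p
count-permute p f g fg gf = sym (ℕ-Sum.sum-permute (λ i → if p i then 1 else 0) (permutation f g fg gf))

count-all-false : ∀ {n} {p : Fin n → Bool} → (∀ i → p i ≡ false) → count p ≡ 0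
count-all-false {zero}          _     = refl
count-all-false {suc n} p≡ff rewrite p≡ff zero = count-all-false (p≡ff ∘ suc)

count-mono : ∀ {n} {p q : Fin n → Bool} → p ⊆ q → count p ≤ count q
count-mono {zero}                  _   = z≤n
count-mono {suc n} {p} {q} p⊆q =
  +-mono-≤ (indicator-mono (p zero) (q zero) (p⊆q zero)) (count-mono (p⊆q ∘ suc))
  where
  indicator-mono : ∀ x y → (x ≡ true → y ≡ true) → (if x then 1 else 0) ≤ (if y then 1 else 0)
  indicator-mono true  _     x⇒y rewrite x⇒y refl = ≤-refl
  indicator-mono false true  _ = z≤n
  indicator-mono false false _ = z≤n

count-∨ : ∀ {n} (p q : Fin n → Bool) → (∀ i → p i ∧ q i ≡ false) →
          count (λ i → p i ∨ q i) ≡ count p + count q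
count-∨ {zero}  p q disjoint = refl
count-∨ {suc n} p q disjoint with p zero | q zero | disjoint zero
... | true  | true  | ()
... | true  | false | _ = cong suc (count-∨ (p ∘ suc) (q ∘ suc) (disjoint ∘ suc))
... | false | true  | _ = trans (cong suc (count-∨ (p ∘ suc) (q ∘ suc) (disjoint ∘ suc)))
                                (sym (+-suc (count (p ∘ suc)) _))
... | false | false | _ = count-∨ (p ∘ suc) (q ∘ suc) (disjoint ∘ suc)

count-split : ∀ {n} (p q : Fin n → Bool) →
              count p ≡ count (λ i → p i ∧ q i) + count (λ i → p i ∧ not (q i))
count-split p q = trans (count-cong recombine) (count-∨ _ _ disjoint)
  where
  recombine : ∀ i → p i ≡ (p i ∧ q i) ∨ (p i ∧ not (q i))
  recombine i with p i | q i
  ... | true  | true  = refl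
  ... | true  | false = refl
  ... | false | _     = refl
  disjoint : ∀ i → (p i ∧ q i) ∧ (p i ∧ not (q i)) ≡ false
  disjoint i with p i | q i
  ... | true  | true  = refl
  ... | true  | false = refl
  ... | false | _     = refl

singleton : ∀ {n} → Fin n → Fin n → Bool
singleton a i = does (i ≟ a)

singleton⇒≡ : ∀ {n} {a i : Fin n} → singleton a i ≡ true → i ≡ a
singleton⇒≡ {a = a} {i} i∈a with i ≟ a
... | yes i≡a = i≡a

count-singleton : ∀ {n} (a : Fin n) → count (singleton a) ≡ 1
count-singleton {suc n} zero    = cong suc (count-all-false {n} {singleton zero ∘ suc} (λ _ → refl))
count-singleton {suc n} (suc a) = count-singleton a

pair : ∀ {n} → Fin n → Fin n → Fin n → Bool
pair a b i = singleton a i ∨ singleton b i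

count-pair : ∀ {n} {a b : Fin n} → a ≢ b → count (pair a b) ≡ 2
count-pair {a = a} {b} a≢b =
  trans (count-∨ (singleton a) (singleton b) disjoint) (cong₂ _+_ (count-singleton a) (count-singleton b))
  where
  disjoint : ∀ i → singleton a i ∧ singleton b i ≡ false
  disjoint i with i ≟ a | i ≟ b
  ... | yes refl | yes refl = ⊥-elim (a≢b refl)
  ... | yes _    | no _     = refl
  ... | no _     | _        = refl

pair-⊆ : ∀ {n} {a b : Fin n} {p : Fin n → Bool} → p a ≡ true → p b ≡ true → pair a b ⊆ p
pair-⊆ {a = a} {b} pa pb i _ with i ≟ a | i ≟ b
... | yes refl | _        = pa
... | no _     | yes refl = pb

count≡1⇒unique : ∀ {n} {p : Fin n → Bool} → count p ≡ 1 →
                 ∀ {a b} → p a ≡ true → p b ≡ true → a ≡ b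
count≡1⇒unique {p = p} ∣p∣≡1 {a} {b} pa pb with a ≟ b
... | yes a≡b = a≡b
... | no  a≢b =
  ⊥-elim (<-irrefl refl (subst₂ _≤_ (count-pair a≢b) ∣p∣≡1 (count-mono {p = pair a b} {p} (pair-⊆ pa pb))))

1≤count⇒∃ : ∀ {n} {p : Fin n → Bool} → 1 ≤ count p → ∃ λ i → p i ≡ true
1≤count⇒∃ {p = p} 1≤∣p∣ with any? (λ i → p i Bool.≟ true)
... | yes found = found
... | no  none  = ⊥-elim (<-irrefl refl (subst (1 ≤_) (count-all-false all-false) 1≤∣p∣))
  where
  all-false : ∀ i → p i ≡ false
  all-false i with p i in pi
  ... | true  = ⊥-elim (none (i , pi))
  ... | false = refl

2≤count⇒∃≢ : ∀ {n} {p : Fin n → Bool} → 2 ≤ count p → ∀ z → ∃ λ w → p w ≡ true × w ≢ z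
2≤count⇒∃≢ {p = p} 2≤∣p∣ z with any? (λ w → (p w Bool.≟ true) ×-dec ¬? (w ≟ z))
... | yes found = found
... | no  none  =
  ⊥-elim (<-irrefl refl (≤-trans 2≤∣p∣ (subst (count p ≤_) (count-singleton z) (count-mono p⊆z))))
  where
  p⊆z : p ⊆ singleton z
  p⊆z w pw with w ≟ z
  ... | yes _   = refl
  ... | no  w≢z = ⊥-elim (none (w , pw , w≢z))

∣p∣≡count-lookup : ∀ {n} (S : Subset n) → ∣ S ∣ ≡ count (lookup S)
∣p∣≡count-lookup []          = refl
∣p∣≡count-lookup (true ∷ S)  = cong suc (∣p∣≡count-lookup S)
∣p∣≡count-lookup (false ∷ S) = ∣p∣≡count-lookup S

does-∈?≡lookup : ∀ {n} (x : Fin n) (S : Subset n) → does (x ∈? S) ≡ lookup S x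
does-∈?≡lookup zero    (true  ∷ S) = refl
does-∈?≡lookup zero    (false ∷ S) = refl
does-∈?≡lookup (suc x) (_     ∷ S) = does-∈?≡lookup x S

first : ∀ {n} → (Fin n → Bool) → Maybe (Fin n)
first {zero}  p = nothing
first {suc n} p = if p zero then just zero else Maybe.map suc (first (p ∘ suc))

first-cong : ∀ {n} {p q : Fin n → Bool} → (∀ i → p i ≡ q i) → first p ≡ first q
first-cong {zero}          _   = refl
first-cong {suc n} {p} {q} p≗q rewrite p≗q zero | first-cong {p = p ∘ suc} {q ∘ suc} (p≗q ∘ suc) = refl

first-just : ∀ {n} {p : Fin n → Bool} {i} → p i ≡ true → ∃ λ j → first p ≡ just j × p j ≡ true
first-just {suc n} {p} pi with p zero in p0
... | true  = zero , refl , p0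
first-just {suc n} {p} {zero}  pi | false with () ← trans (sym pi) p0
first-just {suc n} {p} {suc i} pi | false with first-just {p = p ∘ suc} pi
... | j , first≡j , pj rewrite first≡j = suc j , refl , pj

[n+n]%2≡0 : ∀ n → (n + n) % 2 ≡ 0
[n+n]%2≡0 n = trans (cong (_% 2) n+n≡n*2) (m*n%n≡0 n 2)
  where
  n+n≡n*2 : n + n ≡ n * 2
  n+n≡n*2 = trans (cong (n +_) (sym (+-identityʳ n))) (*-comm 2 n)

n%2≡1⇒n≡1+[n/2]*2 : ∀ n → n % 2 ≡ 1 → n ≡ suc (n / 2 * 2)
n%2≡1⇒n≡1+[n/2]*2 n n%2≡1 = trans (m≡m%n+[m/n]*n n 2) (cong (_+ n / 2 * 2) n%2≡1)

module Involution {n} (σ : Fin n → Fin n) (σ-involutive : ∀ i → σ (σ i) ≡ i) where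

  Invariant : (Fin n → Bool) → Set
  Invariant p = ∀ i → p (σ i) ≡ p i

  fixedPointFree⇒count-even : ∀ {p} → Invariant p → (∀ i → p i ≡ true → σ i ≢ i) →
                              ∃ λ c → count p ≡ c + c
  fixedPointFree⇒count-even {p} p-inv fixedPointFree = count lower , (begin
    count p                                         ≡⟨ count-split p below ⟩
    count lower + count (λ i → p i ∧ not (below i)) ≡⟨ cong (count lower +_) (count-cong upper≡lower∘σ) ⟩
    count lower + count (lower ∘ σ)                 ≡⟨ cong (count lower +_) ∣lower∘σ∣≡∣lower∣ ⟩
    count lower + count lower                       ∎)
    where
    below : Fin n → Bool
    below i = does (i <? σ i)
    lower : Fin n → Bool
    lower i = p i ∧ below i
    ∣lower∘σ∣≡∣lower∣ : count (lower ∘ σ) ≡ count lower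
    ∣lower∘σ∣≡∣lower∣ = count-permute lower σ σ σ-involutive σ-involutive
    upper≡lower∘σ : ∀ i → p i ∧ not (below i) ≡ lower (σ i)
    upper≡lower∘σ i rewrite p-inv i | σ-involutive i with p i in pi | <-cmp i (σ i)
    ... | false | _                 = refl
    ... | true  | tri< i<σi _ σi≮i rewrite dec-true (i <? σ i) i<σi | dec-false (σ i <? i) σi≮i = refl
    ... | true  | tri≈ _ i≡σi _    = ⊥-elim (fixedPointFree i pi (sym i≡σi))
    ... | true  | tri> i≮σi _ σi<i rewrite dec-false (i <? σ i) i≮σi | dec-true (σ i <? i) σi<i = refl

  singleton∘σ : ∀ a i → singleton a (σ i) ≡ singleton (σ a) i
  singleton∘σ a i with σ i ≟ a | i ≟ σ a
  ... | yes _    | yes _    = refl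
  ... | no  _    | no  _    = refl
  ... | yes refl | no  i≢a′ = ⊥-elim (i≢a′ (sym (σ-involutive i)))
  ... | no  σi≢a | yes refl = ⊥-elim (σi≢a (σ-involutive a))

  singleton-invariant : ∀ {a} → σ a ≡ a → Invariant (singleton a)
  singleton-invariant {a} σa≡a i = trans (singleton∘σ a i) (cong (λ b → singleton b i) σa≡a)

  pair-invariant : ∀ {a b} → σ a ≡ a → σ b ≡ b → Invariant (pair a b)
  pair-invariant σa≡a σb≡b i = cong₂ _∨_ (singleton-invariant σa≡a i) (singleton-invariant σb≡b i)

  orbit-invariant : ∀ a → Invariant (pair a (σ a))
  orbit-invariant a i = begin
    singleton a (σ i) ∨ singleton (σ a) (σ i)
      ≡⟨ cong₂ _∨_ (singleton∘σ a i) (singleton∘σ (σ a) i) ⟩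
    singleton (σ a) i ∨ singleton (σ (σ a)) i
      ≡⟨ cong (λ b → singleton (σ a) i ∨ singleton b i) (σ-involutive a) ⟩
    singleton (σ a) i ∨ singleton a i         ≡⟨ ∨-comm (singleton (σ a) i) (singleton a i) ⟩
    singleton a i ∨ singleton (σ a) i         ∎

  InvariantSubset : (Fin n → Bool) → ℕ → Set
  InvariantSubset p k = ∃ λ q → q ⊆ p × Invariant q × count q ≡ k

  orbit-subset : ∀ {p z} → Invariant p → p z ≡ true → σ z ≢ z → InvariantSubset p 2
  orbit-subset {p} {z} p-inv pz σz≢z =
    pair z (σ z) , pair-⊆ pz (trans (p-inv z) pz) , orbit-invariant z , count-pair (σz≢z ∘ sym)

  invariantSubset-of-size-2 : ∀ {p} → Invariant p → 2 ≤ count p → InvariantSubset p 2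
  invariantSubset-of-size-2 {p} p-inv 2≤∣p∣ with 1≤count⇒∃ {p = p} (≤-trans (s≤s z≤n) 2≤∣p∣)
  ... | z , pz with σ z ≟ z
  ...   | no σz≢z = orbit-subset p-inv pz σz≢z
  ...   | yes σz≡z with 2≤count⇒∃≢ {p = p} 2≤∣p∣ z
  ...     | w , pw , w≢z with σ w ≟ w
  ...       | no σw≢w  = orbit-subset p-inv pw σw≢w
  ...       | yes σw≡w = pair z w , pair-⊆ pz pw , pair-invariant σz≡z σw≡w , count-pair (w≢z ∘ sym)

  extend-by-pair : ∀ {p q} → Invariant p → q ⊆ p → Invariant q → 2 + count q ≤ count p →
                   InvariantSubset p (2 + count q)
  extend-by-pair {p} {q} p-inv q⊆p q-inv bound with invariantSubset-of-size-2 rest-inv 2≤∣rest∣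
    where
    rest : Fin n → Bool
    rest i = p i ∧ not (q i)
    rest-inv : Invariant rest
    rest-inv i = cong₂ (λ x y → x ∧ not y) (p-inv i) (q-inv i)
    p∧q≗q : ∀ i → p i ∧ q i ≡ q i
    p∧q≗q i with q i in qi
    ... | true  = cong (_∧ true) (q⊆p i qi)
    ... | false = ∧-zeroʳ (p i)
    ∣p∣≡∣q∣+∣rest∣ : count p ≡ count q + count rest
    ∣p∣≡∣q∣+∣rest∣ = trans (count-split p q) (cong (_+ count rest) (count-cong p∧q≗q))
    2≤∣rest∣ : 2 ≤ count rest
    2≤∣rest∣ = +-cancelˡ-≤ (count q) 2 (count rest) (subst₂ _≤_ (+-comm 2 (count q)) ∣p∣≡∣q∣+∣rest∣ bound)
  ... | r , r⊆rest , r-inv , ∣r∣≡2 =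
    (λ i → q i ∨ r i) , q∨r⊆p , (λ i → cong₂ _∨_ (q-inv i) (r-inv i)) ,
    trans (count-∨ q r disjoint) (trans (cong (count q +_) ∣r∣≡2) (+-comm (count q) 2))
    where
    q∨r⊆p : (λ i → q i ∨ r i) ⊆ p
    q∨r⊆p i q∨r with q i in qi
    ... | true  = q⊆p i qi
    ... | false = ∧-conicalˡ (p i) _ (r⊆rest i q∨r)
    disjoint : ∀ i → q i ∧ r i ≡ false
    disjoint i with q i in qi | r i in ri
    ... | false | _     = refl
    ... | true  | false = refl
    ... | true  | true  with () ← trans (cong not (sym qi)) (∧-conicalʳ (p i) _ (r⊆rest i ri))

  invariantSubset-of-odd-size : ∀ {p a} → Invariant p → p a ≡ true → σ a ≡ a →
                                ∀ m → suc (m * 2) ≤ count p → InvariantSubset p (suc (m * 2))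
  invariantSubset-of-odd-size {p} {a} p-inv pa σa≡a zero _ =
    singleton a , a⊆p , singleton-invariant σa≡a , count-singleton a
    where
    a⊆p : singleton a ⊆ p
    a⊆p i _ with i ≟ a
    ... | yes refl = pa
  invariantSubset-of-odd-size {p} p-inv pa σa≡a (suc m) bound
    with invariantSubset-of-odd-size p-inv pa σa≡a m (≤-trans (m≤n+m _ 2) bound)
  ... | q , q⊆p , q-inv , ∣q∣
    with extend-by-pair p-inv q⊆p q-inv (subst (λ k → 2 + k ≤ count p) (sym ∣q∣) bound)
  ... | r , r⊆p , r-inv , ∣r∣ = r , r⊆p , r-inv , trans ∣r∣ (cong (2 +_) ∣q∣)

  count-odd⇒fixedPoint : ∀ {p} → Invariant p → count p % 2 ≡ 1 → ∃ λ i → p i ≡ true × σ i ≡ i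
  count-odd⇒fixedPoint {p} p-inv odd with any? (λ i → (p i Bool.≟ true) ×-dec (σ i ≟ i))
  ... | yes fixed = fixed
  ... | no  none with fixedPointFree⇒count-even p-inv (λ i pi σi≡i → none (i , pi , σi≡i))
  ...   | c , ∣p∣≡c+c with () ← trans (sym ([n+n]%2≡0 c)) (subst (λ k → k % 2 ≡ 1) ∣p∣≡c+c odd)

module GroupTheory (G : FinGroup) where
  open FinGroup G public

  group : Group 0ℓ 0ℓ
  group = record
    { isGroup = record
      { isMonoid = record
        { isSemigroup = record
          { isMagma = record { isEquivalence = isEquivalence ; ∙-cong = cong₂ _·_ }
          ; assoc   = assoc
          }
        ; identity = identityˡ , identityʳ
        }
      ; inverse = inverseˡ , inverseʳ
      ; ⁻¹-cong = cong inv
      }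
    }

  open Algebra.Properties.Group group public
    using (⁻¹-involutive; ⁻¹-anti-homo-∙; ε⁻¹≈ε; \\-leftDividesˡ; \\-leftDividesʳ; //-rightDividesʳ)

module Cosets (G : FinGroup) (H : Subset (FinGroup.order G)) (H-normal : IsNormalSubgroup G H) where
  open GroupTheory G public

  inH : Fin order → Bool
  inH = lookup H

  ∈⇒inH : ∀ {x} → x ∈ H → inH x ≡ true
  ∈⇒inH = []=⇒lookup

  e∈H : inH e ≡ true
  e∈H = ∈⇒inH (proj₁ H-normal)

  ·∈H : ∀ {x y} → inH x ≡ true → inH y ≡ true → inH (x · y) ≡ true
  ·∈H {x} {y} x∈H y∈H =
    ∈⇒inH (proj₁ (proj₂ H-normal) x y (lookup⇒[]= x H x∈H) (lookup⇒[]= y H y∈H))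

  inv∈H : ∀ {x} → inH x ≡ true → inH (inv x) ≡ true
  inv∈H {x} x∈H = ∈⇒inH (proj₁ (proj₂ (proj₂ H-normal)) x (lookup⇒[]= x H x∈H))

  conj∈H : ∀ g {h} → inH h ≡ true → inH ((g · h) · inv g) ≡ true
  conj∈H g {h} h∈H = ∈⇒inH (proj₂ (proj₂ (proj₂ H-normal)) g h (lookup⇒[]= h H h∈H))

  inH-inv : ∀ x → inH (inv x) ≡ inH x
  inH-inv x = ⇔→≡ (mk⇔ (subst (λ y → inH y ≡ true) (⁻¹-involutive x) ∘ inv∈H) inv∈H)

  inH≡false⇒∉ : ∀ {x} → inH x ≡ false → x ∉ H
  inH≡false⇒∉ x∉H x∈H with () ← trans (sym (∈⇒inH x∈H)) x∉H

  ∉⇒inH≡false : ∀ {x} → x ∉ H → inH x ≡ false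
  ∉⇒inH≡false {x} x∉H with inH x in x∈H
  ... | true  = ⊥-elim (x∉H (lookup⇒[]= x H x∈H))
  ... | false = refl

  coset : Fin order → Fin order → Bool
  coset a z = inH (inv a · z)

  infix 4 _∼_
  _∼_ : Fin order → Fin order → Set
  a ∼ z = coset a z ≡ true

  ∼-refl : ∀ a → a ∼ a
  ∼-refl a = subst (λ x → inH x ≡ true) (sym (inverseˡ a)) e∈H

  ∼-sym : ∀ {a b} → a ∼ b → b ∼ a
  ∼-sym {a} {b} a∼b = subst (λ x → inH x ≡ true) inverse (inv∈H a∼b)
    where
    inverse : inv (inv a · b) ≡ inv b · a
    inverse = trans (⁻¹-anti-homo-∙ (inv a) b) (cong (inv b ·_) (⁻¹-involutive a))

  ∼-trans : ∀ {a b c} → a ∼ b → b ∼ c → a ∼ c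
  ∼-trans {a} {b} {c} a∼b b∼c = subst (λ x → inH x ≡ true) product (·∈H a∼b b∼c)
    where
    product : (inv a · b) · (inv b · c) ≡ inv a · c
    product = trans (assoc (inv a) b _) (cong (inv a ·_) (\\-leftDividesˡ b c))

  coset-congˡ : ∀ {a b} → a ∼ b → ∀ z → coset a z ≡ coset b z
  coset-congˡ a∼b z = ⇔→≡ (mk⇔ (∼-trans (∼-sym a∼b)) (∼-trans a∼b))

  coset-congʳ : ∀ {z z′} → z ∼ z′ → ∀ a → coset a z ≡ coset a z′
  coset-congʳ z∼z′ a = ⇔→≡ (mk⇔ (λ a∼z → ∼-trans a∼z z∼z′) (λ a∼z′ → ∼-trans a∼z′ (∼-sym z∼z′)))

  ∼-inv : ∀ {a b} → a ∼ b → inv a ∼ inv b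
  ∼-inv {a} {b} a∼b = subst (λ x → inH x ≡ true) conjugate (conj∈H a (∼-sym a∼b))
    where
    conjugate : (a · (inv b · a)) · inv a ≡ inv (inv a) · inv b
    conjugate = begin
      (a · (inv b · a)) · inv a ≡⟨ cong (_· inv a) (sym (assoc a (inv b) a)) ⟩
      ((a · inv b) · a) · inv a ≡⟨ //-rightDividesʳ a (a · inv b) ⟩
      a · inv b                 ≡⟨ cong (_· inv b) (⁻¹-involutive a) ⟨
      inv (inv a) · inv b       ∎

  coset-inv : ∀ a z → coset (inv a) (inv z) ≡ coset a z
  coset-inv a z = ⇔→≡ (mk⇔ (subst₂ _∼_ (⁻¹-involutive a) (⁻¹-involutive z) ∘ ∼-inv) ∼-inv)

  coset-inv-selfInverse : ∀ {a} → a ∼ inv a → ∀ z → coset a (inv z) ≡ coset a z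
  coset-inv-selfInverse a∼a⁻¹ z = trans (coset-congˡ a∼a⁻¹ (inv z)) (coset-inv _ z)

  inH≡coset-e : ∀ z → inH z ≡ coset e z
  inH≡coset-e z = cong inH (trans (sym (identityˡ z)) (cong (_· z) (sym ε⁻¹≈ε)))

  inH-cong : ∀ {a b} → a ∼ b → inH a ≡ inH b
  inH-cong {a} {b} a∼b = trans (inH≡coset-e a) (trans (coset-congʳ a∼b e) (sym (inH≡coset-e b)))

  ∼-·H : ∀ y {k} → inH k ≡ true → y ∼ y · k
  ∼-·H y k∈H = subst (λ x → inH x ≡ true) (sym (\\-leftDividesʳ y _)) k∈H

  count-coset-translate : ∀ {a y} {S : Fin order → Bool} → a ∼ y → S ⊆ inH →
                           count (λ z → coset a z ∧ S (inv y · z)) ≡ count S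
  count-coset-translate {a} {y} {S} a∼y S⊆H = begin
    count (λ z → coset a z ∧ S (inv y · z))
      ≡⟨ count-permute _ (y ·_) (inv y ·_) (\\-leftDividesˡ y) (\\-leftDividesʳ y) ⟨
    count (λ k → coset a (y · k) ∧ S (inv y · (y · k))) ≡⟨ count-cong translated ⟩
    count S                                             ∎
    where
    translated : ∀ k → coset a (y · k) ∧ S (inv y · (y · k)) ≡ S k
    translated k rewrite \\-leftDividesʳ y k with S k in k∈S
    ... | true  = trans (∧-identityʳ _) (∼-trans a∼y (∼-·H y (S⊆H k k∈S)))
    ... | false = ∧-zeroʳ _

  -- (y · k)⁻¹ = y⁻¹ · σ y k
  σ : Fin order → Fin order → Fin order
  σ y k = (y · inv k) · inv y

  σ-inverseˡ : ∀ y k → σ (inv y) (σ y k) ≡ k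
  σ-inverseˡ y k = begin
    (inv y · inv ((y · inv k) · inv y)) · inv (inv y) ≡⟨ cong (λ x → (inv y · x) · inv (inv y)) σ⁻¹ ⟩
    (inv y · (y · (k · inv y))) · inv (inv y)         ≡⟨ cong (_· inv (inv y)) (\\-leftDividesʳ y _) ⟩
    (k · inv y) · inv (inv y)                         ≡⟨ //-rightDividesʳ (inv y) k ⟩
    k                                                 ∎
    where
    σ⁻¹ : inv ((y · inv k) · inv y) ≡ y · (k · inv y)
    σ⁻¹ = begin
      inv ((y · inv k) · inv y)         ≡⟨ ⁻¹-anti-homo-∙ (y · inv k) (inv y) ⟩
      inv (inv y) · inv (y · inv k)     ≡⟨ cong₂ _·_ (⁻¹-involutive y) (⁻¹-anti-homo-∙ y (inv k)) ⟩
      y · (inv (inv k) · inv y)         ≡⟨ cong (λ x → y · (x · inv y)) (⁻¹-involutive k) ⟩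
      y · (k · inv y)                   ∎

  σ-inverseʳ : ∀ y k → σ y (σ (inv y) k) ≡ k
  σ-inverseʳ y k = subst (λ w → σ w (σ (inv y) k) ≡ k) (⁻¹-involutive y) (σ-inverseˡ (inv y) k)

  σ-involutive : ∀ {y} → y ≡ inv y → ∀ k → σ y (σ y k) ≡ k
  σ-involutive {y} y≡y⁻¹ k = subst (λ w → σ w (σ y k) ≡ k) (sym y≡y⁻¹) (σ-inverseˡ y k)

  inH-σ : ∀ y k → inH (σ y k) ≡ inH k
  inH-σ y k = ⇔→≡ (mk⇔ (subst (λ x → inH x ≡ true) (σ-inverseˡ y k) ∘ σ∈H (inv y)) (σ∈H y))
    where
    σ∈H : ∀ y {k} → inH k ≡ true → inH (σ y k) ≡ true
    σ∈H y k∈H = conj∈H y (inv∈H k∈H)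

  σ-e : ∀ y → σ y e ≡ e
  σ-e y = begin
    (y · inv e) · inv y ≡⟨ cong (λ x → (y · x) · inv y) ε⁻¹≈ε ⟩
    (y · e) · inv y     ≡⟨ cong (_· inv y) (identityʳ y) ⟩
    y · inv y           ≡⟨ inverseʳ y ⟩
    e                   ∎

  σ-coset : ∀ y x → σ y (inv y · x) ≡ inv (inv y) · inv x
  σ-coset y x = begin
    (y · inv (inv y · x)) · inv y       ≡⟨ cong (λ w → (y · w) · inv y) (⁻¹-anti-homo-∙ (inv y) x) ⟩
    (y · (inv x · inv (inv y))) · inv y ≡⟨ cong (λ w → (y · (inv x · w)) · inv y) (⁻¹-involutive y) ⟩
    (y · (inv x · y)) · inv y           ≡⟨ cong (_· inv y) (sym (assoc y (inv x) y)) ⟩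
    ((y · inv x) · y) · inv y           ≡⟨ //-rightDividesʳ y (y · inv x) ⟩
    y · inv x                           ≡⟨ cong (_· inv x) (⁻¹-involutive y) ⟨
    inv (inv y) · inv x                 ∎

module RegularSets (G : FinGroup) (H : Subset (FinGroup.order G)) (H-normal : IsNormalSubgroup G H) where
  open Cosets G H H-normal

  lookup-nbhd : ∀ X g h → lookup (nbhd G X g) h ≡ lookup X (inv g · h)
  lookup-nbhd X g h
    rewrite lookup∘tabulate (λ h → if does (inv g · h ∈? X) then inside else outside) h
          | does-∈?≡lookup (inv g · h) X
    with lookup X (inv g · h)
  ... | true  = refl
  ... | false = refl

  countInCoset : (Fin order → Bool) → Fin order → ℕ
  countInCoset X a = count (λ z → X z ∧ coset a z)

  ∣H∩nbhd∣≡countInCoset : ∀ X g → ∣ H ∩ nbhd G X g ∣ ≡ countInCoset (lookup X) (inv g)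
  ∣H∩nbhd∣≡countInCoset X g = begin
    ∣ H ∩ nbhd G X g ∣                                     ≡⟨ ∣p∣≡count-lookup (H ∩ nbhd G X g) ⟩
    count (lookup (H ∩ nbhd G X g))                        ≡⟨ count-cong lookup-∩ ⟩
    count (λ h → inH h ∧ lookup X (inv g · h))
      ≡⟨ count-permute _ (g ·_) (inv g ·_) (\\-leftDividesˡ g) (\\-leftDividesʳ g) ⟨
    count (λ z → inH (g · z) ∧ lookup X (inv g · (g · z))) ≡⟨ count-cong swap ⟩
    countInCoset (lookup X) (inv g)                        ∎
    where
    lookup-∩ : ∀ h → lookup (H ∩ nbhd G X g) h ≡ inH h ∧ lookup X (inv g · h)
    lookup-∩ h = trans (lookup-zipWith _∧_ h H (nbhd G X g)) (cong (inH h ∧_) (lookup-nbhd X g h))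
    swap : ∀ z → inH (g · z) ∧ lookup X (inv g · (g · z)) ≡ lookup X z ∧ coset (inv g) z
    swap z = trans (∧-comm (inH (g · z)) _) (cong₂ _∧_ (cong (lookup X) (\\-leftDividesʳ g z))
                                           (cong (λ x → inH (x · z)) (sym (⁻¹-involutive g))))

  regular⇒countInCoset : ∀ {X κ τ a} → IsRegularSetOfCay G X κ τ H → inH a ≡ false →
                         countInCoset (lookup X) a ≡ τ
  regular⇒countInCoset {X} {τ = τ} {a} (_ , outside-count) a∉H = begin
    countInCoset (lookup X) a             ≡⟨ cong (countInCoset (lookup X)) (⁻¹-involutive a) ⟨
    countInCoset (lookup X) (inv (inv a)) ≡⟨ ∣H∩nbhd∣≡countInCoset X (inv a) ⟨
    ∣ H ∩ nbhd G X (inv a) ∣              ≡⟨ outside-count (inv a) (inH≡false⇒∉ a⁻¹∉H) ⟩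
    τ                                     ∎
    where
    a⁻¹∉H : inH (inv a) ≡ false
    a⁻¹∉H = trans (inH-inv a) a∉H

  regular-fromCountInCoset : ∀ {X τ} → (∀ x → lookup X x ≡ true → inH x ≡ false) →
                             (∀ a → inH a ≡ false → countInCoset (lookup X) a ≡ τ) →
                             IsRegularSetOfCay G X 0 τ H
  regular-fromCountInCoset {X} X∩H≡∅ outside-count = inside-count , λ g g∉H →
    trans (∣H∩nbhd∣≡countInCoset X g) (outside-count (inv g) (trans (inH-inv g) (∉⇒inH≡false g∉H)))
    where
    inside-count : ∀ g → g ∈ H → ∣ H ∩ nbhd G X g ∣ ≡ 0
    inside-count g g∈H = trans (∣H∩nbhd∣≡countInCoset X g) (count-all-false disjoint)
      where
      e∼g⁻¹ : e ∼ inv g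
      e∼g⁻¹ = trans (sym (inH≡coset-e (inv g))) (inv∈H (∈⇒inH g∈H))
      disjoint : ∀ z → lookup X z ∧ coset (inv g) z ≡ false
      disjoint z with lookup X z in z∈X
      ... | false = refl
      ... | true  = trans (sym (coset-congˡ e∼g⁻¹ z)) (trans (sym (inH≡coset-e z)) (X∩H≡∅ z z∈X))

  inverseClosed-ofConnectionSet : ∀ {X} → IsConnectionSet G X →
                                  ∀ z → lookup X z ≡ true → lookup X (inv z) ≡ true
  inverseClosed-ofConnectionSet {X} (_ , X-inv) z z∈X = []=⇒lookup (X-inv z (lookup⇒[]= z X z∈X))

  regularSet-fromCountInCoset : ∀ {τ} (X : Fin order → Bool) →
                                (∀ z → X z ≡ true → X (inv z) ≡ true) →
                                (∀ z → X z ≡ true → inH z ≡ false) →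
                                (∀ a → inH a ≡ false → countInCoset X a ≡ τ) →
                                IsRegularSet G 0 τ H
  regularSet-fromCountInCoset {τ} X X-inv X∩H≡∅ outside-count =
    tabulate X , (e∉X , X⁻¹⊆X) , regular-fromCountInCoset X∩H≡∅′ outside-count′
    where
    X≗ : ∀ z → lookup (tabulate X) z ≡ X z
    X≗ = lookup∘tabulate X
    X∩H≡∅′ : ∀ z → lookup (tabulate X) z ≡ true → inH z ≡ false
    X∩H≡∅′ z z∈X = X∩H≡∅ z (trans (sym (X≗ z)) z∈X)
    e∉X : e ∉ tabulate X
    e∉X e∈X with () ← trans (sym e∈H) (X∩H≡∅′ e ([]=⇒lookup e∈X))
    X⁻¹⊆X : ∀ z → z ∈ tabulate X → inv z ∈ tabulate X
    X⁻¹⊆X z z∈X =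
      lookup⇒[]= (inv z) (tabulate X) (trans (X≗ (inv z)) (X-inv z (trans (sym (X≗ z)) ([]=⇒lookup z∈X))))
    outside-count′ : ∀ a → inH a ≡ false → countInCoset (lookup (tabulate X)) a ≡ τ
    outside-count′ a a∉H = trans (count-cong (λ z → cong (_∧ coset a z) (X≗ z))) (outside-count a a∉H)

  module InverseClosedTransversal
    (selfInverse-fixedPoint : ∀ a → inH a ≡ false → a ∼ inv a → ∃ λ z → a ∼ z × inv z ≡ z) where

    -- pick a is the first element of aH ∪ a⁻¹H (among the z = z⁻¹ if aH = a⁻¹H), moved into aH by
    -- inversion. It depends only on the pair {aH, a⁻¹H}, which makes pick (inv a) ≡ inv (pick a).
    candidate : Fin order → Fin order → Bool
    candidate a z = (coset a z ∨ coset (inv a) z) ∧ (not (coset a (inv a)) ∨ does (inv z ≟ z))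

    orient : Fin order → Maybe (Fin order) → Fin order
    orient a (just z) = if coset a z then z else inv z
    orient a nothing  = e

    pick : Fin order → Fin order
    pick a = orient a (first (candidate a))

    candidate-cong : ∀ {a b} → a ∼ b → ∀ z → candidate a z ≡ candidate b z
    candidate-cong {a} {b} a∼b z =
      cong₂ (λ x y → x ∧ (not y ∨ does (inv z ≟ z)))
            (cong₂ _∨_ (coset-congˡ a∼b z) (coset-congˡ (∼-inv a∼b) z))
            (trans (coset-congˡ a∼b (inv a)) (coset-congʳ (∼-inv a∼b) b))

    candidate-inv : ∀ a z → candidate (inv a) z ≡ candidate a z
    candidate-inv a z =
      cong₂ (λ x y → x ∧ (not y ∨ does (inv z ≟ z)))
            (trans (cong (λ b → coset (inv a) z ∨ coset b z) (⁻¹-involutive a))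
                   (∨-comm (coset (inv a) z) _))
            (trans (cong (coset (inv a)) (⁻¹-involutive a)) (⇔→≡ (mk⇔ ∼-sym ∼-sym)))

    candidate-nonempty : ∀ {a} → inH a ≡ false → ∃ λ z → candidate a z ≡ true
    candidate-nonempty {a} a∉H with coset a (inv a) in a∼a⁻¹
    ... | false = a , cong (_∧ true) (cong (_∨ coset (inv a) a) (∼-refl a))
    ... | true with selfInverse-fixedPoint a a∉H a∼a⁻¹
    ...   | z , a∼z , z⁻¹≡z =
      z , cong₂ _∧_ (cong (_∨ coset (inv a) z) a∼z) (dec-true (inv z ≟ z) z⁻¹≡z)

    orient-cong : ∀ {a b} → a ∼ b → ∀ m → orient a m ≡ orient b m
    orient-cong a∼b (just z) = cong (if_then z else inv z) (coset-congˡ a∼b z)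
    orient-cong a∼b nothing  = refl

    pick-cong : ∀ {a b} → a ∼ b → pick a ≡ pick b
    pick-cong {a} {b} a∼b =
      trans (cong (orient a) (first-cong (candidate-cong a∼b))) (orient-cong a∼b (first (candidate b)))

    orient-∼ : ∀ {a m} → candidate a m ≡ true → a ∼ orient a (just m)
    orient-∼ {a} {m} m-candidate with coset a m in a∼m
    ... | true  = a∼m
    ... | false = subst (_∼ inv m) (⁻¹-involutive a) (∼-inv (∧-conicalˡ _ _ m-candidate))

    orient-inv : ∀ {a m} → candidate a m ≡ true → orient (inv a) (just m) ≡ inv (orient a (just m))
    orient-inv {a} {m} m-candidate with coset a m in a∼m | coset (inv a) m in a⁻¹∼m
    ... | true  | false = refl
    ... | false | true  = sym (⁻¹-involutive m)
    ... | true  | true  =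
      sym (singleton⇒≡ (subst (λ b → not b ∨ does (inv m ≟ m) ≡ true) a∼a⁻¹ m-candidate))
      where
      a∼a⁻¹ : a ∼ inv a
      a∼a⁻¹ = ∼-trans a∼m (∼-sym a⁻¹∼m)

    first-candidate : ∀ {a} → inH a ≡ false →
                      ∃ λ m → first (candidate a) ≡ just m × candidate a m ≡ true
    first-candidate a∉H = first-just (proj₂ (candidate-nonempty a∉H))

    pick-∼ : ∀ {a} → inH a ≡ false → a ∼ pick a
    pick-∼ {a} a∉H with first-candidate a∉H
    ... | m , first≡m , m-candidate rewrite first≡m = orient-∼ m-candidate

    pick-inv : ∀ {a} → inH a ≡ false → pick (inv a) ≡ inv (pick a)
    pick-inv {a} a∉H with first-candidate a∉H
    ... | m , first≡m , m-candidate = begin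
      orient (inv a) (first (candidate (inv a))) ≡⟨ cong (orient (inv a)) (first-cong (candidate-inv a)) ⟩
      orient (inv a) (first (candidate a))       ≡⟨ cong (orient (inv a)) first≡m ⟩
      orient (inv a) (just m)                    ≡⟨ orient-inv m-candidate ⟩
      inv (orient a (just m))                    ≡⟨ cong (inv ∘ orient a) first≡m ⟨
      inv (pick a)                               ∎

    transversal : Fin order → Bool
    transversal z = not (inH z) ∧ does (pick z ≟ z)

    transversal∩H≡∅ : ∀ z → transversal z ≡ true → inH z ≡ false
    transversal∩H≡∅ z z∈T = not-injective (∧-conicalˡ _ _ z∈T)

    transversal-inv : ∀ z → transversal z ≡ true → transversal (inv z) ≡ true
    transversal-inv z z∈T =
      cong₂ _∧_ (cong not (trans (inH-inv z) z∉H)) (dec-true (pick (inv z) ≟ inv z) pick-z⁻¹)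
      where
      z∉H : inH z ≡ false
      z∉H = transversal∩H≡∅ z z∈T
      pick-z⁻¹ : pick (inv z) ≡ inv z
      pick-z⁻¹ = trans (pick-inv z∉H) (cong inv (singleton⇒≡ (∧-conicalʳ _ _ z∈T)))

    countInCoset-transversal : ∀ {a} → inH a ≡ false → countInCoset transversal a ≡ 1
    countInCoset-transversal {a} a∉H =
      trans (count-cong (λ z → ⇔→≡ (mk⇔ (only-pick z) (picked z)))) (count-singleton (pick a))
      where
      only-pick : ∀ z → transversal z ∧ coset a z ≡ true → singleton (pick a) z ≡ true
      only-pick z z∈T∩aH = dec-true (z ≟ pick a) (begin
        z      ≡⟨ singleton⇒≡ (∧-conicalʳ (not (inH z)) _ (∧-conicalˡ (transversal z) _ z∈T∩aH)) ⟨
        pick z ≡⟨ pick-cong (∧-conicalʳ (transversal z) _ z∈T∩aH) ⟨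
        pick a ∎)
      a∼pick : a ∼ pick a
      a∼pick = pick-∼ a∉H
      picked : ∀ z → singleton (pick a) z ≡ true → transversal z ∧ coset a z ≡ true
      picked z z≡pick = subst (λ w → transversal w ∧ coset a w ≡ true) (sym (singleton⇒≡ z≡pick))
        (cong₂ _∧_ (cong₂ _∧_ (cong not (trans (inH-cong (∼-sym a∼pick)) a∉H))
                              (dec-true (pick (pick a) ≟ pick a) (sym (pick-cong a∼pick))))
                   a∼pick)

  selfInverseCoset-fixedPoint : ∀ {X} → (∀ z → X z ≡ true → X (inv z) ≡ true) →
                                (∀ a → inH a ≡ false → countInCoset X a % 2 ≡ 1) →
                                ∀ a → inH a ≡ false → a ∼ inv a → ∃ λ z → a ∼ z × inv z ≡ z
  selfInverseCoset-fixedPoint {X} X-inv odd a a∉H a∼a⁻¹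
    with Involution.count-odd⇒fixedPoint inv ⁻¹-involutive X∩aH-inv (odd a a∉H)
    where
    X∩aH-inv : ∀ z → X (inv z) ∧ coset a (inv z) ≡ X z ∧ coset a z
    X∩aH-inv z =
      cong₂ _∧_ (⇔→≡ (mk⇔ (subst (λ w → X w ≡ true) (⁻¹-involutive z) ∘ X-inv (inv z)) (X-inv z)))
                (coset-inv-selfInverse a∼a⁻¹ z)
  ... | z , z∈X∩aH , z⁻¹≡z = z , ∧-conicalʳ (X z) _ z∈X∩aH , z⁻¹≡z

  perfectCode-ofOddRegularSet : ∀ {τ} → τ % 2 ≡ 1 → IsRegularSet G 0 τ H → IsPerfectCode G H
  perfectCode-ofOddRegularSet odd (X , X-conn , X-reg) =
    regularSet-fromCountInCoset transversal transversal-inv transversal∩H≡∅ (λ _ → countInCoset-transversal)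
    where
    open InverseClosedTransversal (selfInverseCoset-fixedPoint (inverseClosed-ofConnectionSet X-conn)
      (λ a a∉H → subst (λ k → k % 2 ≡ 1) (sym (regular⇒countInCoset X-reg a∉H)) odd))

  module CosetRepresentatives
    (Y : Fin order → Bool)
    (Y-inv : ∀ z → Y z ≡ true → Y (inv z) ≡ true)
    (Y-once : ∀ a → inH a ≡ false → countInCoset Y a ≡ 1) where

    -- the element of Y ∩ aH; the default e only occurs for a ∈ H
    rep : Fin order → Fin order
    rep a = fromMaybe e (first (λ z → Y z ∧ coset a z))

    rep-spec : ∀ {a} → inH a ≡ false → Y (rep a) ≡ true × a ∼ rep a
    rep-spec {a} a∉H with 1≤count⇒∃ {p = λ z → Y z ∧ coset a z} (≤-reflexive (sym (Y-once a a∉H)))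
    ... | z , z∈Y∩aH with first-just {p = λ z → Y z ∧ coset a z} z∈Y∩aH
    ...   | r , first≡r , r∈Y∩aH rewrite first≡r =
      ∧-conicalˡ _ _ r∈Y∩aH , ∧-conicalʳ (Y r) _ r∈Y∩aH

    rep-unique : ∀ {a y} → inH a ≡ false → Y y ≡ true → a ∼ y → y ≡ rep a
    rep-unique {a} a∉H y∈Y a∼y with rep-spec a∉H
    ... | rep∈Y , a∼rep =
      count≡1⇒unique (Y-once a a∉H) (cong₂ _∧_ y∈Y a∼y) (cong₂ _∧_ rep∈Y a∼rep)

    rep-cong : ∀ {a b} → inH a ≡ false → a ∼ b → rep b ≡ rep a
    rep-cong {a} {b} a∉H a∼b with rep-spec (trans (sym (inH-cong a∼b)) a∉H)
    ... | rep∈Y , b∼rep = rep-unique a∉H rep∈Y (∼-trans a∼b b∼rep)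

    rep-inv : ∀ {a} → inH a ≡ false → rep (inv a) ≡ inv (rep a)
    rep-inv {a} a∉H with rep-spec a∉H
    ... | rep∈Y , a∼rep = sym (rep-unique (trans (inH-inv a) a∉H) (Y-inv _ rep∈Y) (∼-inv a∼rep))

  module RegularSetFromTransversal
    (Y : Fin order → Bool)
    (Y-inv : ∀ z → Y z ≡ true → Y (inv z) ≡ true)
    (Y-once : ∀ a → inH a ≡ false → countInCoset Y a ≡ 1)
    (m : ℕ) (odd≤∣H∣ : suc (m * 2) ≤ count inH) where

    open CosetRepresentatives Y Y-inv Y-once

    S₀-spec : Involution.InvariantSubset (λ k → k) (λ _ → refl) inH (suc (m * 2))
    S₀-spec =
      Involution.invariantSubset-of-odd-size (λ k → k) (λ _ → refl) (λ _ → refl) e∈H refl m odd≤∣H∣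

    S₀ : Fin order → Bool
    S₀ = proj₁ S₀-spec

    S₀⊆H : S₀ ⊆ inH
    S₀⊆H = proj₁ (proj₂ S₀-spec)

    ∣S₀∣ : count S₀ ≡ suc (m * 2)
    ∣S₀∣ = proj₂ (proj₂ (proj₂ S₀-spec))

    selfInverseOffsets : ∀ {y} (y≡y⁻¹ : y ≡ inv y) →
                       Involution.InvariantSubset (σ y) (σ-involutive y≡y⁻¹) inH (suc (m * 2))
    selfInverseOffsets {y} y≡y⁻¹ =
      Involution.invariantSubset-of-odd-size (σ y) (σ-involutive y≡y⁻¹) (inH-σ y) e∈H (σ-e y) m odd≤∣H∣

    -- X ∩ yH = y · offsets y. Of two cosets yH ≠ y⁻¹H the order on Fin lets the smaller representative
    -- take S₀ and the other its σ-image, as required by offsets-σ.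
    offsetsBy : ∀ y → Tri (y < inv y) (y ≡ inv y) (inv y < y) → Fin order → Bool
    offsetsBy y (tri< _ _ _)      = S₀
    offsetsBy y (tri≈ _ y≡y⁻¹ _) = proj₁ (selfInverseOffsets y≡y⁻¹)
    offsetsBy y (tri> _ _ _)      = S₀ ∘ σ y

    offsets : Fin order → Fin order → Bool
    offsets y = offsetsBy y (<-cmp y (inv y))

    offsets⊆H : ∀ y → offsets y ⊆ inH
    offsets⊆H y = go (<-cmp y (inv y))
      where
      go : ∀ c → offsetsBy y c ⊆ inH
      go (tri< _ _ _)      = S₀⊆H
      go (tri≈ _ y≡y⁻¹ _) = proj₁ (proj₂ (selfInverseOffsets y≡y⁻¹))
      go (tri> _ _ _) k k∈offsets = trans (sym (inH-σ y k)) (S₀⊆H (σ y k) k∈offsets)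

    ∣offsets∣ : ∀ y → count (offsets y) ≡ suc (m * 2)
    ∣offsets∣ y = go (<-cmp y (inv y))
      where
      go : ∀ c → count (offsetsBy y c) ≡ suc (m * 2)
      go (tri< _ _ _)      = ∣S₀∣
      go (tri≈ _ y≡y⁻¹ _) = proj₂ (proj₂ (proj₂ (selfInverseOffsets y≡y⁻¹)))
      go (tri> _ _ _)      =
        trans (count-permute S₀ (σ y) (σ (inv y)) (σ-inverseʳ y) (σ-inverseˡ y)) ∣S₀∣

    offsets-below : ∀ {y} → y < inv y → ∀ k → offsets y k ≡ S₀ k
    offsets-below {y} y<y⁻¹ k = go (<-cmp y (inv y))
      where
      go : ∀ c → offsetsBy y c k ≡ S₀ k
      go (tri< _ _ _)      = refl
      go (tri≈ y≮y⁻¹ _ _) = ⊥-elim (y≮y⁻¹ y<y⁻¹)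
      go (tri> y≮y⁻¹ _ _) = ⊥-elim (y≮y⁻¹ y<y⁻¹)

    offsets-above : ∀ {y} → inv y < y → ∀ k → offsets y k ≡ S₀ (σ y k)
    offsets-above {y} y⁻¹<y k = go (<-cmp y (inv y))
      where
      go : ∀ c → offsetsBy y c k ≡ S₀ (σ y k)
      go (tri< _ _ y⁻¹≮y) = ⊥-elim (y⁻¹≮y y⁻¹<y)
      go (tri≈ _ _ y⁻¹≮y) = ⊥-elim (y⁻¹≮y y⁻¹<y)
      go (tri> _ _ _)      = refl

    offsets-selfInverse : ∀ {y} → y ≡ inv y → ∀ k → offsets y (σ y k) ≡ offsets y k
    offsets-selfInverse {y} y≡y⁻¹ k = go (<-cmp y (inv y))
      where
      go : ∀ c → offsetsBy y c (σ y k) ≡ offsetsBy y c k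
      go (tri< _ y≢y⁻¹ _)   = ⊥-elim (y≢y⁻¹ y≡y⁻¹)
      go (tri≈ _ y≡y⁻¹′ _) = proj₁ (proj₂ (proj₂ (selfInverseOffsets y≡y⁻¹′))) k
      go (tri> _ y≢y⁻¹ _)   = ⊥-elim (y≢y⁻¹ y≡y⁻¹)

    offsets-σ : ∀ y k → offsets y k ≡ true → offsets (inv y) (σ y k) ≡ true
    offsets-σ y k k∈offsets = trans (go (<-cmp y (inv y))) k∈offsets
      where
      y≡y⁻¹⁻¹ : y ≡ inv (inv y)
      y≡y⁻¹⁻¹ = sym (⁻¹-involutive y)
      go : Tri (y < inv y) (y ≡ inv y) (inv y < y) → offsets (inv y) (σ y k) ≡ offsets y k
      go (tri< y<y⁻¹ _ _) = begin
        offsets (inv y) (σ y k) ≡⟨ offsets-above (subst (_< inv y) y≡y⁻¹⁻¹ y<y⁻¹) (σ y k) ⟩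
        S₀ (σ (inv y) (σ y k))  ≡⟨ cong S₀ (σ-inverseˡ y k) ⟩
        S₀ k                    ≡⟨ offsets-below y<y⁻¹ k ⟨
        offsets y k             ∎
      go (tri≈ _ y≡y⁻¹ _) = begin
        offsets (inv y) (σ y k) ≡⟨ cong (λ w → offsets w (σ y k)) y≡y⁻¹ ⟨
        offsets y (σ y k)       ≡⟨ offsets-selfInverse y≡y⁻¹ k ⟩
        offsets y k             ∎
      go (tri> _ _ y⁻¹<y) = begin
        offsets (inv y) (σ y k) ≡⟨ offsets-below (subst (inv y <_) y≡y⁻¹⁻¹ y⁻¹<y) (σ y k) ⟩
        S₀ (σ y k)              ≡⟨ offsets-above y⁻¹<y k ⟨
        offsets y k             ∎

    X : Fin order → Bool
    X x = not (inH x) ∧ offsets (rep x) (inv (rep x) · x)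

    X∩H≡∅ : ∀ x → X x ≡ true → inH x ≡ false
    X∩H≡∅ x x∈X = not-injective (∧-conicalˡ _ _ x∈X)

    X-inv : ∀ x → X x ≡ true → X (inv x) ≡ true
    X-inv x x∈X =
      subst (λ w → not (inH (inv x)) ∧ offsets w (inv w · inv x) ≡ true) (sym (rep-inv x∉H))
      (cong₂ _∧_ (cong not (trans (inH-inv x) x∉H))
                 (subst (λ k → offsets (inv (rep x)) k ≡ true) (σ-coset (rep x) x)
                        (offsets-σ (rep x) _ (∧-conicalʳ (not (inH x)) _ x∈X))))
      where
      x∉H : inH x ≡ false
      x∉H = X∩H≡∅ x x∈X

    countInCoset-X : ∀ a → inH a ≡ false → countInCoset X a ≡ suc (m * 2)
    countInCoset-X a a∉H = begin
      countInCoset X a                                ≡⟨ count-cong X∩aH ⟩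
      count (λ z → coset a z ∧ offsets y (inv y · z))
        ≡⟨ count-coset-translate (proj₂ (rep-spec a∉H)) (offsets⊆H y) ⟩
      count (offsets y)                               ≡⟨ ∣offsets∣ y ⟩
      suc (m * 2)                                     ∎
      where
      y : Fin order
      y = rep a
      X∩aH : ∀ z → X z ∧ coset a z ≡ coset a z ∧ offsets y (inv y · z)
      X∩aH z with coset a z in a∼z
      ... | false = ∧-zeroʳ (X z)
      ... | true  = trans (∧-identityʳ (X z))
                          (cong₂ (λ b w → not b ∧ offsets w (inv w · z))
                                 (trans (inH-cong (∼-sym a∼z)) a∉H) (rep-cong a∉H a∼z))

  oddRegularSet-ofPerfectCode : ∀ m → suc (m * 2) ≤ ∣ H ∣ → IsPerfectCode G H →
                                IsRegularSet G 0 (suc (m * 2)) H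
  oddRegularSet-ofPerfectCode m odd≤∣H∣ (Y , Y-conn , Y-perfect) =
    regularSet-fromCountInCoset X X-inv X∩H≡∅ countInCoset-X
    where
    open RegularSetFromTransversal (lookup Y) (inverseClosed-ofConnectionSet Y-conn)
      (λ _ → regular⇒countInCoset Y-perfect) m
      (subst (suc (m * 2) ≤_) (∣p∣≡count-lookup H) odd≤∣H∣)

lemma2p2 : (G : FinGroup) (H : Subset (FinGroup.order G)) →
    IsNormalSubgroup G H → IsNontrivial G H →
    (τ : ℕ) → 1 ≤ τ → τ ≤ ∣ H ∣ → τ % 2 ≡ 1 →
    (IsRegularSet G 0 τ H ⇔ IsPerfectCode G H)
lemma2p2 G H H-normal _ τ _ τ≤∣H∣ odd = mk⇔ (perfectCode-ofOddRegularSet odd) regularSet-ofPerfectCode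
  where
  open RegularSets G H H-normal
  τ≡1+[τ/2]*2 : τ ≡ suc (τ / 2 * 2)
  τ≡1+[τ/2]*2 = n%2≡1⇒n≡1+[n/2]*2 τ odd
  regularSet-ofPerfectCode : IsPerfectCode G H → IsRegularSet G 0 τ H
  regularSet-ofPerfectCode =
    subst (λ t → IsRegularSet G 0 t H) (sym τ≡1+[τ/2]*2)
    ∘ oddRegularSet-ofPerfectCode (τ / 2) (subst (_≤ ∣ H ∣) τ≡1+[τ/2]*2 τ≤∣H∣)
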